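{- Let $n\ge 3$, let $G_1,G_2$ be disjoint copies of the cycle $C_n$, and let $f:V(G_1)\to V(G_2)$ be a function. Then $\gamma(C_n)=\gamma(C(C_n,f))$ if and only if there is a minimum dominating set $D$ of $C(C_n,f)$, with $D_1=D\cap V(G_1)$ and $D_2=D\cap V(G_2)$, such that either: (1) $D_1=\emptyset$, $D_2$ is a minimum dominating set of $G_2$, and $\mathrm{Range}(f)\subseteq D_2$; or (2) $n\equiv 1\pmod 3$, there is a vertex $v\in V(G_2)$ such that $D_2$ is a minimum dominating set of the induced subgraph $\langle V(G_2)\setminus\{v\}\rangle$, $D_1=\{w\}$ with $f(w)=v$, and $f(V(G_1)\setminus N[w])\subseteq D_2$.
   Context: For disjoint copies $G_1,G_2$ of a graph $G$ and a function $f:V(G_1)\to V(G_2)$, the functigraph $C(G,f)$ has vertex set $V(G_1)\cup V(G_2)$ and edge set $E(G_1)\cup E(G_2)\cup\{uv : u\in V(G_1), v\in V(G_2), v=f(u)\}$. $\gamma(H)$ is the domination number of $H$; $N[w]$ is the closed neighborhood of $w$ in $C(C_n,f)$; $\langle S\rangle$ denotes the induced subgraph on $S$. -}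

module Defs where

open import Data.Nat using (ℕ; zero; suc; _+_; _∸_; _≤_)
open import Data.Fin using (Fin; toℕ; _↑ˡ_; _↑ʳ_; splitAt)
open import Data.Fin.Subset using (Subset; _∈_; _∉_; _⊆_; ∣_∣; ⊤)
open import Data.Vec using (tabulate; lookup)
open import Data.Sum using (_⊎_; inj₁; inj₂)
open import Data.Product using (Σ; ∃; _×_; _,_)
open import Relation.Binary.PropositionalEquality using (_≡_)
open import Relation.Nullary using (¬_)

record Graph : Set₁ where
  field
    N   : ℕ
    Adj : Fin N → Fin N → Set
open Graph public

Cycle : ℕ → Graph
Cycle n = record
  { N = n
  ; Adj = λ i j → (toℕ j ≡ suc (toℕ i)) ⊎ (toℕ i ≡ suc (toℕ j))
                ⊎ ((toℕ i ≡ 0) × (toℕ j ≡ n ∸ 1))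
                ⊎ ((toℕ j ≡ 0) × (toℕ i ≡ n ∸ 1))
  }

-- Vertices of the two copies G₁, G₂ inside Fin (N + N).
left : {N : ℕ} → Fin N → Fin (N + N)
left {N} i = i ↑ˡ N

right : {N : ℕ} → Fin N → Fin (N + N)
right {N} i = N ↑ʳ i

FAdj : (G : Graph) → (Fin (N G) → Fin (N G)) → Fin (N G + N G) → Fin (N G + N G) → Set
FAdj G f x y with splitAt (N G) x | splitAt (N G) y
... | inj₁ i | inj₁ j = Adj G i j
... | inj₂ i | inj₂ j = Adj G i j
... | inj₁ i | inj₂ j = j ≡ f i
... | inj₂ i | inj₁ j = i ≡ f j

Functigraph : (G : Graph) → (Fin (N G) → Fin (N G)) → Graph
Functigraph G f = record { N = N G + N G ; Adj = FAdj G f }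

DominatesIn : (G : Graph) → Subset (N G) → Subset (N G) → Set
DominatesIn G S D = D ⊆ S × (∀ w → w ∈ S → w ∈ D ⊎ Σ (Fin (N G)) (λ u → u ∈ D × Adj G u w))

MinDomIn : (G : Graph) → Subset (N G) → Subset (N G) → Set
MinDomIn G S D = DominatesIn G S D × (∀ D′ → DominatesIn G S D′ → ∣ D ∣ ≤ ∣ D′ ∣)

MinDom : (G : Graph) → Subset (N G) → Set
MinDom G D = MinDomIn G ⊤ D

IsDominationNumber : Graph → ℕ → Set
IsDominationNumber G k = Σ (Subset (N G)) (λ D → MinDom G D × ∣ D ∣ ≡ k)

part₁ : (N : ℕ) → Subset (N + N) → Subset N
part₁ N D = tabulate (λ i → lookup D (left {N} i))

part₂ : (N : ℕ) → Subset (N + N) → Subset N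
part₂ N D = tabulate (λ i → lookup D (right {N} i))

InClosedNbhd : (G : Graph) → Fin (N G) → Fin (N G) → Set
InClosedNbhd G w x = (x ≡ w) ⊎ Adj G w x

module Submission where

-- If D dominates C(Cₙ, f), every vertex of G₂ is the image f(x) of some x ∈ D₁ or lies in the
-- closed neighbourhood of D₂ in G₂, so n ≤ |D₁| + 3|D₂|.  Every third vertex of Cₙ dominates it,
-- so 3γ(Cₙ) ≤ n + 2.  If γ(Cₙ) = γ(C(Cₙ, f)) = |D₁| + |D₂|, these two bounds force |D₁| ≤ 1.
-- For D₁ = ∅, D₂ alone dominates G₂ and G₁ can only be dominated through f.  For D₁ = {w},
-- equality forces n = 3|D₂| + 1; D₂ then dominates Cₙ − f(w), and minimally so, because any set
-- dominating a cycle with one vertex removed has at least (n − 1)/3 vertices.  Conversely, when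
-- n ≡ 1 (mod 3), rotating every third vertex gives (n − 1)/3 vertices dominating Cₙ − v for any v,
-- and adding v to a minimum such set yields a minimum dominating set of Cₙ.

open import Defs
open import Data.Nat using (ℕ; _≤_; _%_; _+_)
open import Function.Bundles using (_⇔_; mk⇔)
open import Data.Fin using (Fin)
open import Data.Fin.Subset using (Subset; _∈_; ⊤; ⊥; ⁅_⁆; _-_)
open import Data.Sum using (_⊎_)
open import Data.Product using (Σ; ∃; _×_)
open import Relation.Binary.PropositionalEquality using (_≡_)
open import Relation.Nullary using (¬_; yes; no)

open import Data.Bool using (Bool; T)
open import Data.Bool.Properties using (T-≡)
open import Data.Empty using (⊥-elim)
open import Data.Fin as Fin using (zero; suc; toℕ; fromℕ; fromℕ<; inject₁; _↑ˡ_; _↑ʳ_; splitAt)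
open import Data.Fin.Induction using (<-weakInduction)
open import Data.Fin.Properties
  using (toℕ-fromℕ; toℕ-fromℕ<; toℕ-inject₁; toℕ-injective; toℕ<n; splitAt-↑ˡ; splitAt-↑ʳ; splitAt⁻¹-↑ˡ; splitAt⁻¹-↑ʳ)
open import Data.Fin.Subset using (_∉_; _⊆_; _∪_; _─_; ∣_∣; inside; outside)
open import Data.Fin.Subset.Properties
open import Data.Nat as ℕ using (zero; suc; _*_; _∸_; _/_; z≤n; s≤s)
open import Data.Nat.DivMod using (m≡m%n+[m/n]*n; [m+kn]%n≡m%n)
open import Data.Nat.Properties
open import Data.Nat.Tactic.RingSolver using (solve-∀)
open import Data.Product using (_,_; proj₁; proj₂)
open import Data.Sum using (inj₁; inj₂; [_,_])
open import Data.Vec using (_∷_; []; here; there; lookup; tabulate)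
open import Data.Vec.Properties using (lookup∘tabulate; tabulate∘lookup; []=⇒lookup; lookup⇒[]=)
open import Function.Base using (_∘_; id)
open import Function.Bundles using (Equivalence)
open import Relation.Binary.PropositionalEquality using (_≢_; refl; sym; trans; cong; subst; module ≡-Reasoning)

private variable
  m n : ℕ

∣p∪q∣≤∣p∣+∣q∣ : (p q : Subset n) → ∣ p ∪ q ∣ ≤ ∣ p ∣ + ∣ q ∣
∣p∪q∣≤∣p∣+∣q∣ []            []            = z≤n
∣p∪q∣≤∣p∣+∣q∣ (outside ∷ p) (outside ∷ q) = ∣p∪q∣≤∣p∣+∣q∣ p q
∣p∪q∣≤∣p∣+∣q∣ (outside ∷ p) (inside  ∷ q) = ≤-trans (s≤s (∣p∪q∣≤∣p∣+∣q∣ p q)) (≤-reflexive (sym (+-suc ∣ p ∣ ∣ q ∣)))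
∣p∪q∣≤∣p∣+∣q∣ (inside  ∷ p) (outside ∷ q) = s≤s (∣p∪q∣≤∣p∣+∣q∣ p q)
∣p∪q∣≤∣p∣+∣q∣ (inside  ∷ p) (inside  ∷ q) = s≤s (≤-trans (∣p∪q∣≤∣p∣+∣q∣ p q) (+-monoʳ-≤ ∣ p ∣ (n≤1+n ∣ q ∣)))

∣p∣≡0⇒p≡⊥ : (p : Subset n) → ∣ p ∣ ≡ 0 → p ≡ ⊥
∣p∣≡0⇒p≡⊥ []            _  = refl
∣p∣≡0⇒p≡⊥ (outside ∷ p) eq = cong (outside ∷_) (∣p∣≡0⇒p≡⊥ p eq)

∣p∣≡1⇒p≡⁅x⁆ : (p : Subset n) → ∣ p ∣ ≡ 1 → Σ (Fin n) (λ x → p ≡ ⁅ x ⁆)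
∣p∣≡1⇒p≡⁅x⁆ (inside  ∷ p) eq = zero , cong (inside ∷_) (∣p∣≡0⇒p≡⊥ p (suc-injective eq))
∣p∣≡1⇒p≡⁅x⁆ (outside ∷ p) eq with ∣p∣≡1⇒p≡⁅x⁆ p eq
... | x , p≡⁅x⁆ = suc x , cong (outside ∷_) p≡⁅x⁆

x∈p─q⇒x∉q : (p q : Subset n) {x : Fin n} → x ∈ p ─ q → x ∉ q
x∈p─q⇒x∉q (_      ∷ p) (inside  ∷ q) ()         here
x∈p─q⇒x∉q (inside ∷ p) (outside ∷ q) here       ()
x∈p─q⇒x∉q (_      ∷ p) (_       ∷ q) (there x∈) (there x∈q) = x∈p─q⇒x∉q p q x∈ x∈q

x∈p-y⇒x≢y : (p : Subset n) {x y : Fin n} → x ∈ p - y → x ≢ y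
x∈p-y⇒x≢y p {y = y} x∈ = x∉⁅y⁆⇒x≢y (x∈p─q⇒x∉q p ⁅ y ⁆ x∈)

x∈tabulate⁺ : (g : Fin n → Bool) {x : Fin n} → T (g x) → x ∈ tabulate g
x∈tabulate⁺ g {x} gx = lookup⇒[]= x _ (trans (lookup∘tabulate g x) (Equivalence.to T-≡ gx))

x∈tabulate⁻ : (g : Fin n → Bool) {x : Fin n} → x ∈ tabulate g → T (g x)
x∈tabulate⁻ g {x} x∈ = Equivalence.from T-≡ (trans (sym (lookup∘tabulate g x)) ([]=⇒lookup x∈))

∈-tabulate-lookup⁺ : (p : Subset m) (h : Fin n → Fin m) {x : Fin n} → h x ∈ p → x ∈ tabulate (λ i → lookup p (h i))
∈-tabulate-lookup⁺ p h {x} hx∈p = lookup⇒[]= x _ (trans (lookup∘tabulate _ x) ([]=⇒lookup hx∈p))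

image : (Fin m → Fin n) → Subset m → Subset n
image g []            = ⊥
image g (inside  ∷ p) = ⁅ g zero ⁆ ∪ image (λ x → g (suc x)) p
image g (outside ∷ p) = image (λ x → g (suc x)) p

∣image∣≤∣p∣ : (g : Fin m → Fin n) (p : Subset m) → ∣ image g p ∣ ≤ ∣ p ∣
∣image∣≤∣p∣ {n = n} g [] = ≤-reflexive (∣⊥∣≡0 n)
∣image∣≤∣p∣ g (outside ∷ p) = ∣image∣≤∣p∣ (λ x → g (suc x)) p
∣image∣≤∣p∣ g (inside  ∷ p) = begin
  ∣ ⁅ g zero ⁆ ∪ image g′ p ∣       ≤⟨ ∣p∪q∣≤∣p∣+∣q∣ ⁅ g zero ⁆ (image g′ p) ⟩
  ∣ ⁅ g zero ⁆ ∣ + ∣ image g′ p ∣  ≡⟨ cong (_+ ∣ image g′ p ∣) (∣⁅x⁆∣≡1 (g zero)) ⟩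
  suc ∣ image g′ p ∣               ≤⟨ s≤s (∣image∣≤∣p∣ g′ p) ⟩
  suc ∣ p ∣                        ∎
  where
  open ≤-Reasoning
  g′ : Fin _ → Fin _
  g′ x = g (suc x)

∈-image⁺ : (g : Fin m → Fin n) (p : Subset m) {x : Fin m} → x ∈ p → g x ∈ image g p
∈-image⁺ g (inside  ∷ p) here       = x∈p∪q⁺ (inj₁ (x∈⁅x⁆ (g zero)))
∈-image⁺ g (inside  ∷ p) (there x∈) = x∈p∪q⁺ (inj₂ (∈-image⁺ (λ x → g (suc x)) p x∈))
∈-image⁺ g (outside ∷ p) (there x∈) = ∈-image⁺ (λ x → g (suc x)) p x∈

∈-image⁻ : (g : Fin m → Fin n) (p : Subset m) {y : Fin n} → y ∈ image g p → ∃ λ x → x ∈ p × g x ≡ y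
∈-image⁻ g [] y∈ = ⊥-elim (∉⊥ y∈)
∈-image⁻ g (outside ∷ p) y∈ with ∈-image⁻ (λ x → g (suc x)) p y∈
... | x , x∈ , eq = suc x , there x∈ , eq
∈-image⁻ g (inside  ∷ p) y∈ with x∈p∪q⁻ ⁅ g zero ⁆ _ y∈
... | inj₁ y∈⁅g0⁆ = zero , here , sym (x∈⁅y⁆⇒x≡y _ y∈⁅g0⁆)
... | inj₂ y∈′ with ∈-image⁻ (λ x → g (suc x)) p y∈′
...   | x , x∈ , eq = suc x , there x∈ , eq

Dominated : (G : Graph) → Subset (N G) → Fin (N G) → Set
Dominated G D w = w ∈ D ⊎ Σ (Fin (N G)) (λ u → u ∈ D × Adj G u w)

Dominated-mono : (G : Graph) {D D′ : Subset (N G)} {w : Fin (N G)} → D ⊆ D′ → Dominated G D w → Dominated G D′ w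
Dominated-mono G D⊆D′ (inj₁ w∈D)             = inj₁ (D⊆D′ w∈D)
Dominated-mono G D⊆D′ (inj₂ (u , u∈D , u~w)) = inj₂ (u , D⊆D′ u∈D , u~w)

dominates-except⇒dominates : (G : Graph) {v : Fin (N G)} {D : Subset (N G)} →
  (∀ w → w ∈ ⊤ - v → Dominated G D w) → v ∈ D → DominatesIn G ⊤ D
dominates-except⇒dominates G {v} {D} dominated v∈D = (λ _ → ∈⊤) , dominated′
  where
  dominated′ : ∀ w → w ∈ ⊤ → Dominated G D w
  dominated′ w _ with w Fin.≟ v
  ... | yes refl = inj₁ v∈D
  ... | no  w≢v  = dominated w (x∈p∧x≢y⇒x∈p-y ∈⊤ w≢v)

γ-minimal : (G : Graph) {k : ℕ} {D : Subset (N G)} → IsDominationNumber G k → DominatesIn G ⊤ D → k ≤ ∣ D ∣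
γ-minimal G (_ , (_ , minimal) , refl) D-dominates = minimal _ D-dominates

automorphism-dominates : (G : Graph) (σ σ⁻¹ : Fin (N G) → Fin (N G)) →
  (∀ x → σ (σ⁻¹ x) ≡ x) → (∀ {x y} → σ x ≡ σ y → x ≡ y) → (∀ {u w} → Adj G u w → Adj G (σ u) (σ w)) →
  {v : Fin (N G)} {D : Subset (N G)} → DominatesIn G (⊤ - v) D → DominatesIn G (⊤ - σ v) (image σ D)
automorphism-dominates G σ σ⁻¹ σσ⁻¹ σ-injective σ-adj {v} {D} (D⊆ , dominated) = image⊆ , dominated′
  where
  image⊆ : image σ D ⊆ ⊤ - σ v
  image⊆ y∈ with ∈-image⁻ σ D y∈
  ... | x , x∈D , refl = x∈p∧x≢y⇒x∈p-y ∈⊤ (λ σx≡σv → x∈p-y⇒x≢y ⊤ (D⊆ x∈D) (σ-injective σx≡σv))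

  dominated′ : ∀ w → w ∈ ⊤ - σ v → Dominated G (image σ D) w
  dominated′ w w∈ with dominated (σ⁻¹ w) (x∈p∧x≢y⇒x∈p-y ∈⊤ (λ { refl → x∈p-y⇒x≢y ⊤ w∈ (sym (σσ⁻¹ w)) }))
  ... | inj₁ x∈D             = inj₁ (subst (_∈ image σ D) (σσ⁻¹ w) (∈-image⁺ σ D x∈D))
  ... | inj₂ (u , u∈D , u~x) = inj₂ (σ u , ∈-image⁺ σ D u∈D , subst (Adj G (σ u)) (σσ⁻¹ w) (σ-adj u~x))

Successor : Fin n → Fin n → Set
Successor {n} x s = toℕ s ≡ suc (toℕ x) ⊎ (toℕ x ≡ n ∸ 1 × toℕ s ≡ 0)

next : Fin n → Fin n
next {suc k} x with suc (toℕ x) ℕ.<? suc k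
... | yes x+1<n = fromℕ< x+1<n
... | no  _     = zero

prev : Fin n → Fin n
prev {suc k} zero    = fromℕ k
prev {suc k} (suc i) = inject₁ i

Successor-next : (x : Fin n) → Successor x (next x)
Successor-next {suc k} x with suc (toℕ x) ℕ.<? suc k
... | yes x+1<n = inj₁ (toℕ-fromℕ< x+1<n)
... | no  x+1≮n = inj₂ (≤-antisym (≤-pred (toℕ<n x)) (≤-pred (≮⇒≥ x+1≮n)) , refl)

Successor-prev : (x : Fin n) → Successor (prev x) x
Successor-prev {suc k} zero    = inj₂ (toℕ-fromℕ k , refl)
Successor-prev {suc k} (suc i) = inj₁ (cong suc (sym (toℕ-inject₁ i)))

last-has-no-successor : {x s : Fin n} → toℕ x ≡ n ∸ 1 → toℕ s ≢ suc (toℕ x)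
last-has-no-successor {suc k} {s = s} x≡k s≡x+1 = <⇒≢ (toℕ<n s) (trans s≡x+1 (cong suc x≡k))

Successor-functional : {x s t : Fin n} → Successor x s → Successor x t → s ≡ t
Successor-functional (inj₁ s≡x+1)       (inj₁ t≡x+1)       = toℕ-injective (trans s≡x+1 (sym t≡x+1))
Successor-functional (inj₁ s≡x+1)       (inj₂ (x≡n-1 , _)) = ⊥-elim (last-has-no-successor x≡n-1 s≡x+1)
Successor-functional (inj₂ (x≡n-1 , _)) (inj₁ t≡x+1)       = ⊥-elim (last-has-no-successor x≡n-1 t≡x+1)
Successor-functional (inj₂ (_ , s≡0))   (inj₂ (_ , t≡0))   = toℕ-injective (trans s≡0 (sym t≡0))

Successor-injective : {x y s : Fin n} → Successor x s → Successor y s → x ≡ y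
Successor-injective (inj₁ s≡x+1)       (inj₁ s≡y+1)       = toℕ-injective (suc-injective (trans (sym s≡x+1) s≡y+1))
Successor-injective (inj₁ s≡x+1)       (inj₂ (_ , s≡0))   with () ← trans (sym s≡x+1) s≡0
Successor-injective (inj₂ (_ , s≡0))   (inj₁ s≡y+1)       with () ← trans (sym s≡y+1) s≡0
Successor-injective (inj₂ (x≡n-1 , _)) (inj₂ (y≡n-1 , _)) = toℕ-injective (trans x≡n-1 (sym y≡n-1))

next-prev : (x : Fin n) → next (prev x) ≡ x
next-prev x = Successor-functional (Successor-next (prev x)) (Successor-prev x)

prev-next : (x : Fin n) → prev (next x) ≡ x
prev-next x = Successor-injective (Successor-prev (next x)) (Successor-next x)

next-injective : {x y : Fin n} → next x ≡ next y → x ≡ y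
next-injective {x = x} {y} eq = trans (sym (prev-next x)) (trans (cong prev eq) (prev-next y))

next-fromℕ : (k : ℕ) → next (fromℕ k) ≡ zero
next-fromℕ k = Successor-functional (Successor-next (fromℕ k)) (inj₂ (toℕ-fromℕ k , refl))

next-inject₁ : {k : ℕ} (i : Fin k) → next (inject₁ i) ≡ suc i
next-inject₁ i = Successor-functional (Successor-next (inject₁ i)) (inj₁ (cong suc (sym (toℕ-inject₁ i))))

Successor⇒adj : {u w : Fin n} → Successor u w → Adj (Cycle n) u w
Successor⇒adj (inj₁ w≡u+1)         = inj₁ w≡u+1
Successor⇒adj (inj₂ (u≡n-1 , w≡0)) = inj₂ (inj₂ (inj₂ (w≡0 , u≡n-1)))

adj-sym : {u w : Fin n} → Adj (Cycle n) u w → Adj (Cycle n) w u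
adj-sym (inj₁ w≡u+1)              = inj₂ (inj₁ w≡u+1)
adj-sym (inj₂ (inj₁ u≡w+1))       = inj₁ u≡w+1
adj-sym (inj₂ (inj₂ (inj₁ ends))) = inj₂ (inj₂ (inj₂ ends))
adj-sym (inj₂ (inj₂ (inj₂ ends))) = inj₂ (inj₂ (inj₁ ends))

adj-next : (u : Fin n) → Adj (Cycle n) u (next u)
adj-next u = Successor⇒adj (Successor-next u)

adj⇒next : {u w : Fin n} → Adj (Cycle n) u w → w ≡ next u ⊎ u ≡ next w
adj⇒next (inj₁ w≡u+1)                        = inj₁ (Successor-functional (inj₁ w≡u+1) (Successor-next _))
adj⇒next (inj₂ (inj₁ u≡w+1))                 = inj₂ (Successor-functional (inj₁ u≡w+1) (Successor-next _))
adj⇒next (inj₂ (inj₂ (inj₁ (u≡0 , w≡n-1)))) = inj₂ (Successor-functional (inj₂ (w≡n-1 , u≡0)) (Successor-next _))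
adj⇒next (inj₂ (inj₂ (inj₂ (w≡0 , u≡n-1)))) = inj₁ (Successor-functional (inj₂ (u≡n-1 , w≡0)) (Successor-next _))

next-preserves-adj : {u w : Fin n} → Adj (Cycle n) u w → Adj (Cycle n) (next u) (next w)
next-preserves-adj {u = u} {w} u~w with adj⇒next u~w
... | inj₁ refl = adj-next (next u)
... | inj₂ refl = adj-sym (adj-next (next w))

closedNbhd : Subset n → Subset n
closedNbhd D = D ∪ (image next D ∪ image prev D)

Dominated⇒∈closedNbhd : {D : Subset n} {w : Fin n} → Dominated (Cycle n) D w → w ∈ closedNbhd D
Dominated⇒∈closedNbhd (inj₁ w∈D) = x∈p∪q⁺ (inj₁ w∈D)
Dominated⇒∈closedNbhd {D = D} (inj₂ (u , u∈D , u~w)) with adj⇒next u~w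
... | inj₁ refl = x∈p∪q⁺ (inj₂ (x∈p∪q⁺ (inj₁ (∈-image⁺ next D u∈D))))
... | inj₂ refl = x∈p∪q⁺ (inj₂ (x∈p∪q⁺ (inj₂ (subst (_∈ image prev D) (prev-next _) (∈-image⁺ prev D u∈D)))))

∣closedNbhd∣≤∣D∣*3 : (D : Subset n) → ∣ closedNbhd D ∣ ≤ ∣ D ∣ * 3
∣closedNbhd∣≤∣D∣*3 D = begin
  ∣ D ∪ (image next D ∪ image prev D) ∣         ≤⟨ ∣p∪q∣≤∣p∣+∣q∣ D _ ⟩
  ∣ D ∣ + ∣ image next D ∪ image prev D ∣       ≤⟨ +-monoʳ-≤ ∣ D ∣ (∣p∪q∣≤∣p∣+∣q∣ (image next D) _) ⟩
  ∣ D ∣ + (∣ image next D ∣ + ∣ image prev D ∣) ≤⟨ +-monoʳ-≤ ∣ D ∣ (+-mono-≤ (∣image∣≤∣p∣ next D) (∣image∣≤∣p∣ prev D)) ⟩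
  ∣ D ∣ + (∣ D ∣ + ∣ D ∣)                       ≡⟨ d+[d+d]≡d*3 ∣ D ∣ ⟩
  ∣ D ∣ * 3                                     ∎
  where
  open ≤-Reasoning
  d+[d+d]≡d*3 : ∀ d → d + (d + d) ≡ d * 3
  d+[d+d]≡d*3 = solve-∀

n≤∣X∣+∣D∣*3 : (X D : Subset n) → (∀ w → w ∈ X ⊎ Dominated (Cycle n) D w) → n ≤ ∣ X ∣ + ∣ D ∣ * 3
n≤∣X∣+∣D∣*3 {n} X D covered = begin
  n                         ≡⟨ ∣⊤∣≡n n ⟨
  ∣ ⊤ {n} ∣                 ≤⟨ p⊆q⇒∣p∣≤∣q∣ ⊤⊆ ⟩
  ∣ X ∪ closedNbhd D ∣      ≤⟨ ∣p∪q∣≤∣p∣+∣q∣ X _ ⟩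
  ∣ X ∣ + ∣ closedNbhd D ∣  ≤⟨ +-monoʳ-≤ ∣ X ∣ (∣closedNbhd∣≤∣D∣*3 D) ⟩
  ∣ X ∣ + ∣ D ∣ * 3         ∎
  where
  open ≤-Reasoning
  ⊤⊆ : ⊤ ⊆ X ∪ closedNbhd D
  ⊤⊆ {w} _ with covered w
  ... | inj₁ w∈X       = x∈p∪q⁺ (inj₁ w∈X)
  ... | inj₂ dominated = x∈p∪q⁺ (inj₂ (Dominated⇒∈closedNbhd dominated))

dominates⇒n≤∣D∣*3 : {D : Subset n} → DominatesIn (Cycle n) ⊤ D → n ≤ ∣ D ∣ * 3
dominates⇒n≤∣D∣*3 {n} {D} (_ , dominated) =
  subst (n ≤_) (cong (_+ ∣ D ∣ * 3) (∣⊥∣≡0 n)) (n≤∣X∣+∣D∣*3 ⊥ D (λ w → inj₂ (dominated w ∈⊤)))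

dominates-except⇒n≤1+∣D∣*3 : {v : Fin n} {D : Subset n} → DominatesIn (Cycle n) (⊤ - v) D → n ≤ suc (∣ D ∣ * 3)
dominates-except⇒n≤1+∣D∣*3 {n} {v} {D} (_ , dominated) =
  subst (n ≤_) (cong (_+ ∣ D ∣ * 3) (∣⁅x⁆∣≡1 v)) (n≤∣X∣+∣D∣*3 ⁅ v ⁆ D covered)
  where
  covered : ∀ w → w ∈ ⁅ v ⁆ ⊎ Dominated (Cycle n) D w
  covered w with w Fin.≟ v
  ... | yes refl = inj₁ (x∈⁅x⁆ v)
  ... | no  w≢v  = inj₂ (dominated w (x∈p∧x≢y⇒x∈p-y ∈⊤ w≢v))

mod₃ : ℕ → ℕ
mod₃ 0                   = 0
mod₃ 1                   = 1
mod₃ 2                   = 2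
mod₃ (suc (suc (suc t))) = mod₃ t

mod₃-cases : (t : ℕ) → mod₃ t ≡ 0 ⊎ mod₃ t ≡ 1 ⊎ mod₃ t ≡ 2
mod₃-cases 0                   = inj₁ refl
mod₃-cases 1                   = inj₂ (inj₁ refl)
mod₃-cases 2                   = inj₂ (inj₂ refl)
mod₃-cases (suc (suc (suc t))) = mod₃-cases t

mod₃-suc : (t : ℕ) → mod₃ (suc t) ≡ mod₃ (suc (mod₃ t))
mod₃-suc 0                   = refl
mod₃-suc 1                   = refl
mod₃-suc 2                   = refl
mod₃-suc (suc (suc (suc t))) = mod₃-suc t

mod₃-suc⁻¹ : (t : ℕ) {r : ℕ} → mod₃ (suc t) ≡ suc r → mod₃ t ≡ r
mod₃-suc⁻¹ 0                   refl = refl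
mod₃-suc⁻¹ 1                   refl = refl
mod₃-suc⁻¹ 2                   ()
mod₃-suc⁻¹ (suc (suc (suc t))) eq   = mod₃-suc⁻¹ t eq

mod₃[q*3]≡0 : (q : ℕ) → mod₃ (q * 3) ≡ 0
mod₃[q*3]≡0 zero    = refl
mod₃[q*3]≡0 (suc q) = mod₃[q*3]≡0 q

everyThird : ℕ → (n : ℕ) → Subset n
everyThird r n = tabulate (λ x → mod₃ (toℕ x) ℕ.≡ᵇ r)

∈everyThird⁺ : {r : ℕ} {x : Fin n} → mod₃ (toℕ x) ≡ r → x ∈ everyThird r n
∈everyThird⁺ {r = r} eq = x∈tabulate⁺ (λ x → mod₃ (toℕ x) ℕ.≡ᵇ r) (≡⇒≡ᵇ _ _ eq)

∈everyThird⁻ : {r : ℕ} {x : Fin n} → x ∈ everyThird r n → mod₃ (toℕ x) ≡ r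
∈everyThird⁻ {r = r} x∈ = ≡ᵇ⇒≡ _ _ (x∈tabulate⁻ (λ x → mod₃ (toℕ x) ℕ.≡ᵇ r) x∈)

-- no wrap-around case: the residue of vertex 0 is 0, never suc r
prev∈everyThird : {r : ℕ} (w : Fin n) → mod₃ (toℕ w) ≡ suc r → prev w ∈ everyThird r n
prev∈everyThird w w≡r+1 with Successor-prev w
... | inj₁ w≡p+1       = ∈everyThird⁺ (mod₃-suc⁻¹ (toℕ (prev w)) (trans (cong mod₃ (sym w≡p+1)) w≡r+1))
... | inj₂ (_ , w≡0) with () ← trans (cong mod₃ (sym w≡0)) w≡r+1

∣everyThird0∣*3≤n+2 : (n : ℕ) → ∣ everyThird 0 n ∣ * 3 ≤ n + 2
∣everyThird0∣*3≤n+2 0                   = z≤n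
∣everyThird0∣*3≤n+2 1                   = s≤s (s≤s (s≤s z≤n))
∣everyThird0∣*3≤n+2 2                   = s≤s (s≤s (s≤s z≤n))
∣everyThird0∣*3≤n+2 (suc (suc (suc n))) = s≤s (s≤s (s≤s (∣everyThird0∣*3≤n+2 n)))

∣everyThird1∣≡q : (q : ℕ) → ∣ everyThird 1 (suc (q * 3)) ∣ ≡ q
∣everyThird1∣≡q q = shifted q
  where
  shifted : (q : ℕ) → ∣ tabulate {n = q * 3} (λ x → mod₃ (suc (toℕ x)) ℕ.≡ᵇ 1) ∣ ≡ q
  shifted zero    = refl
  shifted (suc q) = cong suc (shifted q)

everyThird0-dominates : (n : ℕ) → DominatesIn (Cycle n) ⊤ (everyThird 0 n)
everyThird0-dominates n = (λ _ → ∈⊤) , dominated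
  where
  dominated : (w : Fin n) → w ∈ ⊤ → Dominated (Cycle n) (everyThird 0 n) w
  dominated w _ with mod₃-cases (toℕ w)
  ... | inj₁ w≡0        = inj₁ (∈everyThird⁺ w≡0)
  ... | inj₂ (inj₁ w≡1) = inj₂ (prev w , prev∈everyThird w w≡1 , Successor⇒adj (Successor-prev w))
  ... | inj₂ (inj₂ w≡2) = inj₂ (next w , next∈ (Successor-next w) , adj-sym (adj-next w))
    where
    next∈ : Successor w (next w) → next w ∈ everyThird 0 n
    next∈ (inj₁ s≡w+1)     = ∈everyThird⁺ (trans (cong mod₃ s≡w+1) (trans (mod₃-suc (toℕ w)) (cong (λ r → mod₃ (suc r)) w≡2)))
    next∈ (inj₂ (_ , s≡0)) = ∈everyThird⁺ (cong mod₃ s≡0)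

everyThird1-dominates : (q : ℕ) →
  DominatesIn (Cycle (suc (q * 3))) (⊤ - fromℕ (q * 3)) (everyThird 1 (suc (q * 3)))
everyThird1-dominates q = ⊆⊤-last , dominated
  where
  last : Fin (suc (q * 3))
  last = fromℕ (q * 3)

  ≢last : {x : Fin (suc (q * 3))} → mod₃ (toℕ x) ≡ 1 → x ≢ last
  ≢last x≡1 refl with () ← trans (sym (trans (cong mod₃ (toℕ-fromℕ (q * 3))) (mod₃[q*3]≡0 q))) x≡1

  ⊆⊤-last : everyThird 1 (suc (q * 3)) ⊆ ⊤ - last
  ⊆⊤-last x∈ = x∈p∧x≢y⇒x∈p-y ∈⊤ (≢last (∈everyThird⁻ x∈))

  dominated : (w : Fin (suc (q * 3))) → w ∈ ⊤ - last → Dominated (Cycle _) (everyThird 1 _) w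
  dominated w w∈ with mod₃-cases (toℕ w)
  ... | inj₂ (inj₁ w≡1) = inj₁ (∈everyThird⁺ w≡1)
  ... | inj₂ (inj₂ w≡2) = inj₂ (prev w , prev∈everyThird w w≡2 , Successor⇒adj (Successor-prev w))
  ... | inj₁ w≡0        = inj₂ (next w , next∈ (Successor-next w) , adj-sym (adj-next w))
    where
    next∈ : Successor w (next w) → next w ∈ everyThird 1 _
    next∈ (inj₁ s≡w+1)       = ∈everyThird⁺ (trans (cong mod₃ s≡w+1) (trans (mod₃-suc (toℕ w)) (cong (λ r → mod₃ (suc r)) w≡0)))
    next∈ (inj₂ (w≡q*3 , _)) = ⊥-elim (x∈p-y⇒x≢y ⊤ w∈ (toℕ-injective (trans w≡q*3 (sym (toℕ-fromℕ (q * 3))))))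

γ[Cₙ]*3≤n+2 : {k : ℕ} → IsDominationNumber (Cycle n) k → k * 3 ≤ n + 2
γ[Cₙ]*3≤n+2 {n} γ≡k = ≤-trans (*-monoˡ-≤ 3 (γ-minimal (Cycle n) γ≡k (everyThird0-dominates n))) (∣everyThird0∣*3≤n+2 n)

-- Starting from the vertices ≡ 1 (mod 3), which avoid the last vertex, rotate by next until v is avoided.
dominating-set-avoiding : (q : ℕ) (v : Fin (suc (q * 3))) →
  Σ (Subset (suc (q * 3))) (λ E → DominatesIn (Cycle (suc (q * 3))) (⊤ - v) E × ∣ E ∣ ≤ q)
dominating-set-avoiding q =
  <-weakInduction P (subst P (next-fromℕ (q * 3)) (rotate last-case)) (λ i → subst P (next-inject₁ i) ∘ rotate)
  where
  P : Fin (suc (q * 3)) → Set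
  P v = Σ (Subset (suc (q * 3))) (λ E → DominatesIn (Cycle (suc (q * 3))) (⊤ - v) E × ∣ E ∣ ≤ q)

  last-case : P (fromℕ (q * 3))
  last-case = everyThird 1 _ , everyThird1-dominates q , ≤-reflexive (∣everyThird1∣≡q q)

  rotate : {v : Fin (suc (q * 3))} → P v → P (next v)
  rotate (E , E-dominates , ∣E∣≤q) =
    image next E , automorphism-dominates (Cycle _) next prev next-prev next-injective next-preserves-adj E-dominates ,
    ≤-trans (∣image∣≤∣p∣ next E) ∣E∣≤q

∣minDom-except∣≤q : (q : ℕ) → n ≡ suc (q * 3) → {v : Fin n} {E : Subset n} → MinDomIn (Cycle n) (⊤ - v) E → ∣ E ∣ ≤ q
∣minDom-except∣≤q q refl {v} (_ , minimal) with dominating-set-avoiding q v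
... | E′ , E′-dominates , ∣E′∣≤q = ≤-trans (minimal E′ E′-dominates) ∣E′∣≤q

γ≡γ[Cₙ-v]+1 : n % 3 ≡ 1 → {v : Fin n} {E : Subset n} →
  MinDomIn (Cycle n) (⊤ - v) E → IsDominationNumber (Cycle n) (suc ∣ E ∣)
γ≡γ[Cₙ-v]+1 {n} n%3≡1 {v} {E} E-min@((_ , E-dominated) , _) =
  X , (X-dominates , X-minimal) , ≤-antisym ∣X∣≤1+∣E∣ (1+∣E∣≤∣D∣ X X-dominates)
  where
  q : ℕ
  q = n / 3

  n≡1+q*3 : n ≡ suc (q * 3)
  n≡1+q*3 = trans (m≡m%n+[m/n]*n n 3) (cong (_+ q * 3) n%3≡1)

  X : Subset n
  X = E ∪ ⁅ v ⁆

  X-dominates : DominatesIn (Cycle n) ⊤ X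
  X-dominates = dominates-except⇒dominates (Cycle n)
    (λ w w∈ → Dominated-mono (Cycle n) (p⊆p∪q ⁅ v ⁆) (E-dominated w w∈)) (x∈p∪q⁺ (inj₂ (x∈⁅x⁆ v)))

  ∣X∣≤1+∣E∣ : ∣ X ∣ ≤ suc ∣ E ∣
  ∣X∣≤1+∣E∣ = ≤-trans (∣p∪q∣≤∣p∣+∣q∣ E ⁅ v ⁆) (≤-reflexive (trans (cong (∣ E ∣ +_) (∣⁅x⁆∣≡1 v)) (+-comm ∣ E ∣ 1)))

  1+∣E∣≤∣D∣ : ∀ D → DominatesIn (Cycle n) ⊤ D → suc ∣ E ∣ ≤ ∣ D ∣
  1+∣E∣≤∣D∣ D D-dominates = ≤-trans (s≤s (∣minDom-except∣≤q q n≡1+q*3 E-min))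
    (*-cancelʳ-< 3 q ∣ D ∣ (subst (_≤ ∣ D ∣ * 3) n≡1+q*3 (dominates⇒n≤∣D∣*3 D-dominates)))

  X-minimal : ∀ D → DominatesIn (Cycle n) ⊤ D → ∣ X ∣ ≤ ∣ D ∣
  X-minimal D D-dominates = ≤-trans ∣X∣≤1+∣E∣ (1+∣E∣≤∣D∣ D D-dominates)

∣p∣≡∣part₁∣+∣part₂∣ : (n : ℕ) (p : Subset (n + n)) → ∣ p ∣ ≡ ∣ part₁ n p ∣ + ∣ part₂ n p ∣
∣p∣≡∣part₁∣+∣part₂∣ n = split n n
  where
  split : ∀ a b (p : Subset (a + b)) →
    ∣ p ∣ ≡ ∣ tabulate (λ i → lookup p (i ↑ˡ b)) ∣ + ∣ tabulate (λ i → lookup p (a ↑ʳ i)) ∣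
  split zero    b p             = cong ∣_∣ (sym (tabulate∘lookup p))
  split (suc a) b (inside  ∷ p) = cong suc (split a b p)
  split (suc a) b (outside ∷ p) = split a b p

module _ (G : Graph) (f : Fin (N G) → Fin (N G)) where

  private
    F : Graph
    F = Functigraph G f

  left-left-adj : (i j : Fin (N G)) → Adj F (left {N G} i) (left {N G} j) ≡ Adj G i j
  left-left-adj i j rewrite splitAt-↑ˡ (N G) i (N G) | splitAt-↑ˡ (N G) j (N G) = refl

  left-right-adj : (i j : Fin (N G)) → Adj F (left {N G} i) (right {N G} j) ≡ (j ≡ f i)
  left-right-adj i j rewrite splitAt-↑ˡ (N G) i (N G) | splitAt-↑ʳ (N G) (N G) j = refl

  right-left-adj : (i j : Fin (N G)) → Adj F (right {N G} i) (left {N G} j) ≡ (i ≡ f j)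
  right-left-adj i j rewrite splitAt-↑ʳ (N G) (N G) i | splitAt-↑ˡ (N G) j (N G) = refl

  right-right-adj : (i j : Fin (N G)) → Adj F (right {N G} i) (right {N G} j) ≡ Adj G i j
  right-right-adj i j rewrite splitAt-↑ʳ (N G) (N G) i | splitAt-↑ʳ (N G) (N G) j = refl

  vertex-view : (x : Fin (N G + N G)) → (∃ λ i → left {N G} i ≡ x) ⊎ (∃ λ j → right {N G} j ≡ x)
  vertex-view x with splitAt (N G) x in eq
  ... | inj₁ i = inj₁ (i , splitAt⁻¹-↑ˡ eq)
  ... | inj₂ j = inj₂ (j , splitAt⁻¹-↑ʳ eq)

  module _ (D : Subset (N G + N G)) where

    private
      D₁ D₂ : Subset (N G)
      D₁ = part₁ (N G) D
      D₂ = part₂ (N G) D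

    right-dominated : {y : Fin (N G)} → Dominated F D (right y) → y ∈ image f D₁ ⊎ Dominated G D₂ y
    right-dominated (inj₁ y∈D) = inj₂ (inj₁ (∈-tabulate-lookup⁺ D right y∈D))
    right-dominated {y} (inj₂ (x , x∈D , x~y)) with vertex-view x
    ... | inj₁ (i , refl) = inj₁ (subst (_∈ image f D₁) (sym (subst id (left-right-adj i y) x~y))
                                        (∈-image⁺ f D₁ (∈-tabulate-lookup⁺ D left x∈D)))
    ... | inj₂ (j , refl) = inj₂ (inj₂ (j , ∈-tabulate-lookup⁺ D right x∈D , subst id (right-right-adj j y) x~y))

    left-dominated : {y : Fin (N G)} → Dominated F D (left y) → Dominated G D₁ y ⊎ f y ∈ D₂
    left-dominated (inj₁ y∈D) = inj₁ (inj₁ (∈-tabulate-lookup⁺ D left y∈D))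
    left-dominated {y} (inj₂ (x , x∈D , x~y)) with vertex-view x
    ... | inj₁ (i , refl) = inj₁ (inj₂ (i , ∈-tabulate-lookup⁺ D left x∈D , subst id (left-left-adj i y) x~y))
    ... | inj₂ (j , refl) = inj₂ (subst (_∈ D₂) (subst id (right-left-adj j y) x~y) (∈-tabulate-lookup⁺ D right x∈D))

functigraph-cycle-bound : (f : Fin n → Fin n) {D : Subset (n + n)} →
  DominatesIn (Functigraph (Cycle n) f) ⊤ D → n ≤ ∣ part₁ n D ∣ + ∣ part₂ n D ∣ * 3
functigraph-cycle-bound {n} f {D} (_ , dominated) = begin
  n                            ≤⟨ n≤∣X∣+∣D∣*3 (image f D₁) D₂ covered ⟩
  ∣ image f D₁ ∣ + ∣ D₂ ∣ * 3  ≤⟨ +-monoˡ-≤ (∣ D₂ ∣ * 3) (∣image∣≤∣p∣ f D₁) ⟩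
  ∣ D₁ ∣ + ∣ D₂ ∣ * 3          ∎
  where
  open ≤-Reasoning
  D₁ D₂ : Subset n
  D₁ = part₁ n D
  D₂ = part₂ n D
  covered : ∀ y → y ∈ image f D₁ ⊎ Dominated (Cycle n) D₂ y
  covered y = right-dominated (Cycle n) f D (dominated (right y) ∈⊤)

a*3≤a+2⇒a≤1 : (a : ℕ) → a * 3 ≤ a + 2 → a ≤ 1
a*3≤a+2⇒a≤1 a a*3≤a+2 = *-cancelʳ-≤ a 1 2 (+-cancelˡ-≤ a (a * 2) 2 (subst (_≤ a + 2) (*-suc a 2) a*3≤a+2))

squeeze-a≤1 : (a b n : ℕ) → (a + b) * 3 ≤ n + 2 → n ≤ a + b * 3 → a ≤ 1
squeeze-a≤1 a b n upper lower = a*3≤a+2⇒a≤1 a (+-cancelʳ-≤ (b * 3) (a * 3) (a + 2) (begin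
  a * 3 + b * 3   ≡⟨ *-distribʳ-+ 3 a b ⟨
  (a + b) * 3     ≤⟨ upper ⟩
  n + 2           ≤⟨ +-monoˡ-≤ 2 lower ⟩
  a + b * 3 + 2   ≡⟨ swap a (b * 3) ⟩
  a + 2 + b * 3   ∎))
  where
  open ≤-Reasoning
  swap : ∀ x y → x + y + 2 ≡ x + 2 + y
  swap = solve-∀

squeeze-n≡1+b*3 : (b n : ℕ) → (1 + b) * 3 ≤ n + 2 → n ≤ 1 + b * 3 → n ≡ suc (b * 3)
squeeze-n≡1+b*3 b n upper lower =
  ≤-antisym lower (≤-pred (≤-pred (subst ((1 + b) * 3 ≤_) (+-comm n 2) upper)))

module _ {n : ℕ} (f : Fin n → Fin n) where

  private
    F : Graph
    F = Functigraph (Cycle n) f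

  EmptyLeftPart : Subset (n + n) → Set
  EmptyLeftPart D = part₁ n D ≡ ⊥ × MinDom (Cycle n) (part₂ n D) × (∀ u → f u ∈ part₂ n D)

  SingletonLeftPart : Subset (n + n) → Set
  SingletonLeftPart D = n % 3 ≡ 1 × Σ (Fin n) (λ v → MinDomIn (Cycle n) (⊤ - v) (part₂ n D) ×
    Σ (Fin n) (λ w → part₁ n D ≡ ⁅ w ⁆ × f w ≡ v ×
      (∀ u → ¬ InClosedNbhd F (left {n} w) (left {n} u) → f u ∈ part₂ n D)))

  EmptyLeftPart⇒γ : {D : Subset (n + n)} → EmptyLeftPart D → IsDominationNumber (Cycle n) ∣ D ∣
  EmptyLeftPart⇒γ {D} (D₁≡⊥ , D₂-min , _) = part₂ n D , D₂-min , (begin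
    ∣ part₂ n D ∣                  ≡⟨ cong (_+ ∣ part₂ n D ∣) (trans (cong ∣_∣ D₁≡⊥) (∣⊥∣≡0 n)) ⟨
    ∣ part₁ n D ∣ + ∣ part₂ n D ∣  ≡⟨ ∣p∣≡∣part₁∣+∣part₂∣ n D ⟨
    ∣ D ∣                          ∎)
    where open ≡-Reasoning

  SingletonLeftPart⇒γ : {D : Subset (n + n)} → SingletonLeftPart D → IsDominationNumber (Cycle n) ∣ D ∣
  SingletonLeftPart⇒γ {D} (n%3≡1 , v , D₂-min , w , D₁≡⁅w⁆ , _) =
    subst (IsDominationNumber (Cycle n)) (sym ∣D∣≡1+∣D₂∣) (γ≡γ[Cₙ-v]+1 n%3≡1 D₂-min)
    where
    ∣D∣≡1+∣D₂∣ : ∣ D ∣ ≡ suc ∣ part₂ n D ∣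
    ∣D∣≡1+∣D₂∣ = trans (∣p∣≡∣part₁∣+∣part₂∣ n D) (cong (_+ ∣ part₂ n D ∣) (trans (cong ∣_∣ D₁≡⁅w⁆) (∣⁅x⁆∣≡1 w)))

  module _ {D : Subset (n + n)} (γ≡∣D∣ : IsDominationNumber (Cycle n) ∣ D ∣) (D-dominates : DominatesIn F ⊤ D) where

    private
      D₁ D₂ : Subset n
      D₁ = part₁ n D
      D₂ = part₂ n D

      ∣D∣≡∣D₁∣+∣D₂∣ : ∣ D ∣ ≡ ∣ D₁ ∣ + ∣ D₂ ∣
      ∣D∣≡∣D₁∣+∣D₂∣ = ∣p∣≡∣part₁∣+∣part₂∣ n D

      upper : (∣ D₁ ∣ + ∣ D₂ ∣) * 3 ≤ n + 2
      upper = subst (λ k → k * 3 ≤ n + 2) ∣D∣≡∣D₁∣+∣D₂∣ (γ[Cₙ]*3≤n+2 γ≡∣D∣)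

      lower : n ≤ ∣ D₁ ∣ + ∣ D₂ ∣ * 3
      lower = functigraph-cycle-bound f D-dominates

      right-dominated′ : ∀ y → y ∈ image f D₁ ⊎ Dominated (Cycle n) D₂ y
      right-dominated′ y = right-dominated (Cycle n) f D (proj₂ D-dominates (right y) ∈⊤)

      left-dominated′ : ∀ y → Dominated (Cycle n) D₁ y ⊎ f y ∈ D₂
      left-dominated′ y = left-dominated (Cycle n) f D (proj₂ D-dominates (left y) ∈⊤)

    ∣D₁∣≤1 : ∣ D₁ ∣ ≤ 1
    ∣D₁∣≤1 = squeeze-a≤1 ∣ D₁ ∣ ∣ D₂ ∣ n upper lower

    ∣D₁∣≡0⇒EmptyLeftPart : ∣ D₁ ∣ ≡ 0 → EmptyLeftPart D
    ∣D₁∣≡0⇒EmptyLeftPart ∣D₁∣≡0 = D₁≡⊥ , (((λ _ → ∈⊤) , D₂-dominated) , D₂-minimal) , range⊆D₂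
      where
      D₁≡⊥ : D₁ ≡ ⊥
      D₁≡⊥ = ∣p∣≡0⇒p≡⊥ D₁ ∣D₁∣≡0

      ∉D₁ : ∀ {i} → i ∉ D₁
      ∉D₁ i∈ = ∉⊥ (subst (_ ∈_) D₁≡⊥ i∈)

      D₂-dominated : ∀ y → y ∈ ⊤ → Dominated (Cycle n) D₂ y
      D₂-dominated y _ with right-dominated′ y
      ... | inj₁ y∈image = ⊥-elim (∉D₁ (proj₁ (proj₂ (∈-image⁻ f D₁ y∈image))))
      ... | inj₂ dominated = dominated

      D₂-minimal : ∀ D′ → DominatesIn (Cycle n) ⊤ D′ → ∣ D₂ ∣ ≤ ∣ D′ ∣
      D₂-minimal D′ D′-dominates = ≤-trans (≤-reflexive (trans (cong (_+ ∣ D₂ ∣) (sym ∣D₁∣≡0)) (sym ∣D∣≡∣D₁∣+∣D₂∣)))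
        (γ-minimal (Cycle n) γ≡∣D∣ D′-dominates)

      range⊆D₂ : ∀ u → f u ∈ D₂
      range⊆D₂ u with left-dominated′ u
      ... | inj₁ (inj₁ u∈D₁)            = ⊥-elim (∉D₁ u∈D₁)
      ... | inj₁ (inj₂ (i , i∈D₁ , _)) = ⊥-elim (∉D₁ i∈D₁)
      ... | inj₂ fu∈D₂                 = fu∈D₂

    ∣D₁∣≡1⇒SingletonLeftPart : ∣ D₁ ∣ ≡ 1 → SingletonLeftPart D
    ∣D₁∣≡1⇒SingletonLeftPart ∣D₁∣≡1 =
      n%3≡1 , v , ((D₂⊆⊤-v , D₂-dominated) , D₂-minimal) , w , D₁≡⁅w⁆ , refl , outside-N[w]⇒f∈D₂
      where
      n≡1+∣D₂∣*3 : n ≡ suc (∣ D₂ ∣ * 3)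
      n≡1+∣D₂∣*3 = squeeze-n≡1+b*3 ∣ D₂ ∣ n (subst (λ a → (a + ∣ D₂ ∣) * 3 ≤ n + 2) ∣D₁∣≡1 upper)
                                   (subst (λ a → n ≤ a + ∣ D₂ ∣ * 3) ∣D₁∣≡1 lower)

      n%3≡1 : n % 3 ≡ 1
      n%3≡1 = subst (λ m → m % 3 ≡ 1) (sym n≡1+∣D₂∣*3) ([m+kn]%n≡m%n 1 ∣ D₂ ∣ 3)

      w : Fin n
      w = proj₁ (∣p∣≡1⇒p≡⁅x⁆ D₁ ∣D₁∣≡1)

      D₁≡⁅w⁆ : D₁ ≡ ⁅ w ⁆
      D₁≡⁅w⁆ = proj₂ (∣p∣≡1⇒p≡⁅x⁆ D₁ ∣D₁∣≡1)

      ∈D₁⇒≡w : ∀ {i} → i ∈ D₁ → i ≡ w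
      ∈D₁⇒≡w i∈ = x∈⁅y⁆⇒x≡y w (subst (_ ∈_) D₁≡⁅w⁆ i∈)

      v : Fin n
      v = f w

      D₂-dominated : ∀ y → y ∈ ⊤ - v → Dominated (Cycle n) D₂ y
      D₂-dominated y y∈ with right-dominated′ y
      ... | inj₂ dominated = dominated
      ... | inj₁ y∈image with ∈-image⁻ f D₁ y∈image
      ...   | i , i∈D₁ , refl = ⊥-elim (x∈p-y⇒x≢y ⊤ y∈ (cong f (∈D₁⇒≡w i∈D₁)))

      -- otherwise D₂ alone would dominate Cₙ with fewer than γ(Cₙ) = ∣ D ∣ vertices
      v∉D₂ : v ∉ D₂
      v∉D₂ v∈D₂ = 1+n≰n (begin
        suc ∣ D₂ ∣            ≡⟨ cong (_+ ∣ D₂ ∣) ∣D₁∣≡1 ⟨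
        ∣ D₁ ∣ + ∣ D₂ ∣       ≡⟨ ∣D∣≡∣D₁∣+∣D₂∣ ⟨
        ∣ D ∣                 ≤⟨ γ-minimal (Cycle n) γ≡∣D∣ (dominates-except⇒dominates (Cycle n) D₂-dominated v∈D₂) ⟩
        ∣ D₂ ∣                ∎)
        where open ≤-Reasoning

      D₂⊆⊤-v : D₂ ⊆ ⊤ - v
      D₂⊆⊤-v {x} x∈D₂ = x∈p∧x≢y⇒x∈p-y ∈⊤ (λ { refl → v∉D₂ x∈D₂ })

      D₂-minimal : ∀ D′ → DominatesIn (Cycle n) (⊤ - v) D′ → ∣ D₂ ∣ ≤ ∣ D′ ∣
      D₂-minimal D′ D′-dominates =
        *-cancelʳ-≤ ∣ D₂ ∣ ∣ D′ ∣ 3 (≤-pred (subst (_≤ suc (∣ D′ ∣ * 3)) n≡1+∣D₂∣*3 (dominates-except⇒n≤1+∣D∣*3 D′-dominates)))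

      outside-N[w]⇒f∈D₂ : ∀ u → ¬ InClosedNbhd F (left {n} w) (left {n} u) → f u ∈ D₂
      outside-N[w]⇒f∈D₂ u u∉N[w] with left-dominated′ u
      ... | inj₁ (inj₁ u∈D₁)              = ⊥-elim (u∉N[w] (inj₁ (cong left (∈D₁⇒≡w u∈D₁))))
      ... | inj₁ (inj₂ (i , i∈D₁ , i~u)) with ∈D₁⇒≡w i∈D₁
      ...   | refl = ⊥-elim (u∉N[w] (inj₂ (subst id (sym (left-left-adj (Cycle n) f i u)) i~u)))
      outside-N[w]⇒f∈D₂ u u∉N[w] | inj₂ fu∈D₂ = fu∈D₂

    γ≡∣D∣⇒EmptyLeftPart⊎SingletonLeftPart : EmptyLeftPart D ⊎ SingletonLeftPart D
    γ≡∣D∣⇒EmptyLeftPart⊎SingletonLeftPart with ∣ D₁ ∣ in ∣D₁∣≡a | ∣D₁∣≤1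
    ... | 0 | _ = inj₁ (∣D₁∣≡0⇒EmptyLeftPart ∣D₁∣≡a)
    ... | 1 | _ = inj₂ (∣D₁∣≡1⇒SingletonLeftPart ∣D₁∣≡a)
    ... | suc (suc _) | s≤s ()

theorem3p2 : (n : ℕ) → 3 ≤ n → (f : Fin n → Fin n) →
    (Σ ℕ (λ k → IsDominationNumber (Cycle n) k × IsDominationNumber (Functigraph (Cycle n) f) k))
    ⇔
    (Σ (Subset (n + n)) (λ D → MinDom (Functigraph (Cycle n) f) D ×
    ( (part₁ n D ≡ ⊥ × MinDom (Cycle n) (part₂ n D) × (∀ u → f u ∈ part₂ n D))
    ⊎ (n % 3 ≡ 1 × Σ (Fin n) (λ v → MinDomIn (Cycle n) (⊤ - v) (part₂ n D) ×
    Σ (Fin n) (λ w → part₁ n D ≡ ⁅ w ⁆ × f w ≡ v ×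
    (∀ u → ¬ InClosedNbhd (Functigraph (Cycle n) f) (left {n} w) (left {n} u) → f u ∈ part₂ n D)))))))
theorem3p2 n _ f = mk⇔
  (λ { (k , γ≡k , D , D-min , ∣D∣≡k) →
         D , D-min , γ≡∣D∣⇒EmptyLeftPart⊎SingletonLeftPart f (subst (IsDominationNumber (Cycle n)) (sym ∣D∣≡k) γ≡k) (proj₁ D-min) })
  (λ { (D , D-min , D-shape) →
         ∣ D ∣ , [ EmptyLeftPart⇒γ f {D} , SingletonLeftPart⇒γ f {D} ] D-shape , D , D-min , refl })
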